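{- Let $n$ be even and $F\colon\mathbb F_2^n\to\mathbb F_2^n$ a plateaued APN function. If $|\mathrm{Im}(F)|=\frac{2^n+2}{3}$, then $F$ has no balanced component functions.
   Context: Scalar product $\langle x,y\rangle=\sum x_iy_i$; component functions $F_b(x)=\langle b,F(x)\rangle$ for $b\ne0$; $W_f(a)=\sum_x(-1)^{f(x)+\langle a,x\rangle}$. $f$ is $t$-plateaued if $|W_f(a)|\in\{0,2^{(n+t)/2}\}$ for all $a$; $f$ is balanced if it takes value $0$ exactly $2^{n-1}$ times. $F$ is plateaued if each $F_b$, $b\ne0$, is $s_b$-plateaued for some $s_b$. $F$ is APN if for all $a\ne0$ and all $b$ the equation $F(x+a)+F(x)=b$ has at most $2$ solutions. $\mathrm{Im}(F)$ is the image set. -}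

module Defs where

open import Data.Bool using (Bool; true; false; _xor_; _∧_)
import Data.Bool as B
open import Data.Nat using (ℕ; zero; suc; _+_; _*_; _^_; _∸_; _≤_)
open import Data.Integer as ℤ using (ℤ; ∣_∣)
open import Data.Vec using (Vec; []; _∷_; zipWith; foldr′; replicate)
open import Data.Vec.Properties using (≡-dec)
open import Data.List as L using (List; []; _∷_; _++_; map; filter; length)
open import Data.List.Relation.Unary.Any using (any?)
open import Data.Product using (Σ; ∃; _×_; _,_)
open import Data.Sum using (_⊎_)
open import Relation.Binary.PropositionalEquality using (_≡_)
open import Relation.Nullary using (¬_; Dec)
open import Relation.Nullary.Decidable using (¬?)

-- 𝔽₂ⁿ as Boolean vectors of length n (false = 0, true = 1)
𝔽₂^ : ℕ → Set
𝔽₂^ n = Vec Bool n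

_≟v_ : ∀ {n} (x y : 𝔽₂^ n) → Dec (x ≡ y)
_≟v_ = ≡-dec B._≟_

_⊕_ : ∀ {n} → 𝔽₂^ n → 𝔽₂^ n → 𝔽₂^ n
_⊕_ = zipWith _xor_

𝟎 : ∀ {n} → 𝔽₂^ n
𝟎 = replicate _ false

⟨_,_⟩ : ∀ {n} → 𝔽₂^ n → 𝔽₂^ n → Bool
⟨ x , y ⟩ = foldr′ _xor_ false (zipWith _∧_ x y)

allVecs : (n : ℕ) → List (𝔽₂^ n)
allVecs zero = [] ∷ []
allVecs (suc n) = map (false ∷_) (allVecs n) ++ map (true ∷_) (allVecs n)

count : ∀ {n} {P : 𝔽₂^ n → Set} → ((x : 𝔽₂^ n) → Dec (P x)) → ℕ
count {n} P? = length (filter P? (allVecs n))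

sgn : Bool → ℤ
sgn false = ℤ.+ 1
sgn true  = ℤ.- (ℤ.+ 1)

walsh : ∀ {n} → (𝔽₂^ n → Bool) → 𝔽₂^ n → ℤ
walsh {n} f a = L.foldr ℤ._+_ (ℤ.+ 0) (map (λ x → sgn (f x xor ⟨ a , x ⟩)) (allVecs n))

-- f is t-plateaued: |W_f(a)| ∈ {0, 2^{(n+t)/2}} for all a
-- (the exponent (n+t)/2 is written as h with n + t ≡ 2 * h)
IsPlateauedWith : ∀ {n} → ℕ → (𝔽₂^ n → Bool) → Set
IsPlateauedWith {n} t f =
  Σ ℕ λ h → (n + t ≡ 2 * h) ×
    ((a : 𝔽₂^ n) → (∣ walsh f a ∣ ≡ 0) ⊎ (∣ walsh f a ∣ ≡ 2 ^ h))

IsBalanced : ∀ {n} → (𝔽₂^ n → Bool) → Set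
IsBalanced {n} f = count (λ x → f x B.≟ false) ≡ 2 ^ (n ∸ 1)

component : ∀ {n m} → (𝔽₂^ n → 𝔽₂^ m) → 𝔽₂^ m → 𝔽₂^ n → Bool
component F b x = ⟨ b , F x ⟩

IsPlateaued : ∀ {n} → (𝔽₂^ n → 𝔽₂^ n) → Set
IsPlateaued {n} F = (b : 𝔽₂^ n) → ¬ (b ≡ 𝟎) → ∃ λ s → IsPlateauedWith s (component F b)

IsAPN : ∀ {n} → (𝔽₂^ n → 𝔽₂^ n) → Set
IsAPN {n} F = (a b : 𝔽₂^ n) → ¬ (a ≡ 𝟎) →
  count (λ x → (F (x ⊕ a) ⊕ F x) ≟v b) ≤ 2

imageSize : ∀ {n} → (𝔽₂^ n → 𝔽₂^ n) → ℕ
imageSize {n} F = count (λ y → any? (λ x → F x ≟v y) (allVecs n))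

IsEven : ℕ → Set
IsEven n = ∃ λ m → n ≡ 2 * m

-- Write N = 2ⁿ, W_b for the Walsh transform of the component F_b, C for the number of pairs
-- (x, y) with F x = F y, and Q for the number of quadruples with x + y = z + w and
-- F x + F y = F z + F w. Orthogonality of characters gives Σ_b W_b(0)² = N·C and
-- Σ_{a,b} W_b(a)⁴ = N²·Q. If |W_b| takes only the values 0 and 2^h_b, Parseval gives
-- Σ_a W_b(a)⁴ = 4^h_b·N² ≥ N²·W_b(0)², and a balanced component b₀ has W_b₀(0) = 0; summing over b
-- therefore yields N·C + 4^h_b₀ ≤ Q. The APN property bounds Q ≤ N(3N − 2), and (p − 2)(p − 3) ≥ 0
-- for the preimage sizes p gives C ≥ 3N − 4 once 3·|Im F| = N + 2, so 4^h_b₀ ≤ 2N. On the other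
-- hand W_b₀(0) = 0 and Parseval force 4^h_b₀ > N, and for even n no power of 4 lies in (N, 2N].

module Submission where

open import Defs
open import Algebra.Bundles using (CommutativeRing)
open import Data.Bool as Bool using (Bool; true; false; not; _xor_; _∧_)
open import Data.Bool.Properties
  using (xor-comm; xor-assoc; xor-identityʳ; ∧-distribˡ-xor; ∧-comm; xor-∧-commutativeRing)
open import Data.Empty using (⊥-elim)
open import Data.List using (List; []; _∷_; _++_; map; foldr; length; filter; cartesianProduct)
open import Data.List.Properties using (length-++; length-map; length-filter; filter-none)
open import Data.List.Relation.Unary.Any using (Any; any?)
open import Data.List.Relation.Unary.All.Properties using (¬Any⇒All¬)
open import Data.Nat as ℕ using (ℕ; zero; suc; _^_)
import Data.Nat.Properties as ℕ
open import Data.Nat.Tactic.RingSolver using () renaming (solve-∀ to ℕ-solve-∀)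
open import Data.Product using (_×_; _,_; ∃; proj₁; proj₂)
open import Data.Sum using (_⊎_; inj₁; inj₂)
open import Data.Vec using ([]; _∷_)
open import Data.Vec.Properties
  using (∷-injectiveˡ; ∷-injectiveʳ; zipWith-comm; zipWith-assoc; zipWith-identityʳ)
open import Function using (_∘_; id)
open import Relation.Binary.PropositionalEquality
open import Relation.Nullary using (¬_; Dec; yes; no)
open import Algebra.Properties.CommutativeSemigroup
  (CommutativeRing.+-commutativeSemigroup xor-∧-commutativeRing)
  using () renaming (interchange to xor-interchange)

⊕-comm : ∀ {n} (x y : 𝔽₂^ n) → x ⊕ y ≡ y ⊕ x
⊕-comm = zipWith-comm xor-comm

⊕-assoc : ∀ {n} (x y z : 𝔽₂^ n) → (x ⊕ y) ⊕ z ≡ x ⊕ (y ⊕ z)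
⊕-assoc = zipWith-assoc xor-assoc

⊕-identityʳ : ∀ {n} (x : 𝔽₂^ n) → x ⊕ 𝟎 ≡ x
⊕-identityʳ = zipWith-identityʳ xor-identityʳ

⊕-self : ∀ {n} (x : 𝔽₂^ n) → x ⊕ x ≡ 𝟎
⊕-self [] = refl
⊕-self (false ∷ x) = cong (false ∷_) (⊕-self x)
⊕-self (true ∷ x) = cong (false ∷_) (⊕-self x)

⊕-cancelˡ : ∀ {n} (x y : 𝔽₂^ n) → x ⊕ (x ⊕ y) ≡ y
⊕-cancelˡ x y = begin
  x ⊕ (x ⊕ y) ≡⟨ ⊕-assoc x x y ⟨
  (x ⊕ x) ⊕ y ≡⟨ cong (_⊕ y) (⊕-self x) ⟩
  𝟎 ⊕ y       ≡⟨ ⊕-comm 𝟎 y ⟩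
  y ⊕ 𝟎       ≡⟨ ⊕-identityʳ y ⟩
  y           ∎
  where open ≡-Reasoning

⊕≡𝟎⇒≡ : ∀ {n} (x y : 𝔽₂^ n) → x ⊕ y ≡ 𝟎 → x ≡ y
⊕≡𝟎⇒≡ x y eq = begin
  x           ≡⟨ ⊕-identityʳ x ⟨
  x ⊕ 𝟎       ≡⟨ cong (x ⊕_) eq ⟨
  x ⊕ (x ⊕ y) ≡⟨ ⊕-cancelˡ x y ⟩
  y           ∎
  where open ≡-Reasoning

⟨⟩-comm : ∀ {n} (a x : 𝔽₂^ n) → ⟨ a , x ⟩ ≡ ⟨ x , a ⟩
⟨⟩-comm [] [] = refl
⟨⟩-comm (a ∷ as) (x ∷ xs) = cong₂ _xor_ (∧-comm a x) (⟨⟩-comm as xs)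

⟨𝟎,⟩≡false : ∀ {n} (x : 𝔽₂^ n) → ⟨ 𝟎 , x ⟩ ≡ false
⟨𝟎,⟩≡false [] = refl
⟨𝟎,⟩≡false (_ ∷ x) = ⟨𝟎,⟩≡false x

⟨⟩-distribʳ-⊕ : ∀ {n} (a x y : 𝔽₂^ n) → ⟨ a , x ⊕ y ⟩ ≡ ⟨ a , x ⟩ xor ⟨ a , y ⟩
⟨⟩-distribʳ-⊕ [] [] [] = refl
⟨⟩-distribʳ-⊕ (a ∷ as) (x ∷ xs) (y ∷ ys) = begin
  (a ∧ (x xor y)) xor ⟨ as , xs ⊕ ys ⟩
    ≡⟨ cong₂ _xor_ (∧-distribˡ-xor a x y) (⟨⟩-distribʳ-⊕ as xs ys) ⟩
  ((a ∧ x) xor (a ∧ y)) xor (⟨ as , xs ⟩ xor ⟨ as , ys ⟩)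
    ≡⟨ xor-interchange (a ∧ x) (a ∧ y) ⟨ as , xs ⟩ ⟨ as , ys ⟩ ⟩
  ((a ∧ x) xor ⟨ as , xs ⟩) xor ((a ∧ y) xor ⟨ as , ys ⟩) ∎
  where open ≡-Reasoning

5*k≤k*k+6 : ∀ k → 5 ℕ.* k ℕ.≤ k ℕ.* k ℕ.+ 6
5*k≤k*k+6 0 = ℕ.z≤n
5*k≤k*k+6 1 = ℕ.m≤m+n 5 2
5*k≤k*k+6 2 = ℕ.≤-refl
5*k≤k*k+6 (suc (suc (suc j))) = ℕ.≤-trans (ℕ.m≤m+n (5 ℕ.* (3 ℕ.+ j)) (j ℕ.* j ℕ.+ j)) (ℕ.≤-reflexive (expand j))
  where
  expand : ∀ j → 5 ℕ.* (3 ℕ.+ j) ℕ.+ (j ℕ.* j ℕ.+ j) ≡ (3 ℕ.+ j) ℕ.* (3 ℕ.+ j) ℕ.+ 6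
  expand = ℕ-solve-∀

2^[2m]≡2^m*2^m : ∀ m → 2 ^ (2 ℕ.* m) ≡ 2 ^ m ℕ.* 2 ^ m
2^[2m]≡2^m*2^m m = trans (ℕ.^-distribˡ-+-* 2 m (m ℕ.+ 0)) (cong (λ e → 2 ^ m ℕ.* 2 ^ e) (ℕ.+-identityʳ m))

4^m<4^h⇒2*4^m<4^h : ∀ m h → 2 ^ m ℕ.* 2 ^ m ℕ.< 2 ^ h ℕ.* 2 ^ h → 2 ℕ.* (2 ^ m ℕ.* 2 ^ m) ℕ.< 2 ^ h ℕ.* 2 ^ h
4^m<4^h⇒2*4^m<4^h m h 4^m<4^h with m ℕ.<? h
... | no m≮h = ⊥-elim (ℕ.<⇒≱ 4^m<4^h (ℕ.*-mono-≤ 2^h≤2^m 2^h≤2^m))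
  where
  2^h≤2^m : 2 ^ h ℕ.≤ 2 ^ m
  2^h≤2^m = ℕ.^-monoʳ-≤ 2 (ℕ.≮⇒≥ m≮h)
... | yes m<h = ℕ.<-≤-trans doubled (ℕ.*-mono-≤ 2^[1+m]≤2^h 2^[1+m]≤2^h)
  where
  2^[1+m]≤2^h : 2 ^ suc m ℕ.≤ 2 ^ h
  2^[1+m]≤2^h = ℕ.^-monoʳ-≤ 2 m<h
  expand : ∀ a → (2 ℕ.* a) ℕ.* (2 ℕ.* a) ≡ 2 ℕ.* (a ℕ.* a) ℕ.+ 2 ℕ.* (a ℕ.* a)
  expand = ℕ-solve-∀
  0<2*4^m : 0 ℕ.< 2 ℕ.* (2 ^ m ℕ.* 2 ^ m)
  0<2*4^m = ℕ.<-≤-trans (ℕ.s≤s ℕ.z≤n) (ℕ.*-monoʳ-≤ 2 (ℕ.*-mono-≤ (ℕ.m^n>0 2 m) (ℕ.m^n>0 2 m)))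
  doubled : 2 ℕ.* (2 ^ m ℕ.* 2 ^ m) ℕ.< 2 ^ suc m ℕ.* 2 ^ suc m
  doubled = subst (2 ℕ.* (2 ^ m ℕ.* 2 ^ m) ℕ.<_) (sym (expand (2 ^ m))) (ℕ.m<m+n _ 0<2*4^m)

module _ where
  open import Data.Integer using (ℤ; +_; -[1+_]; ∣_∣; _+_; _*_; -_; _-_; _≤_; +≤+; +<+; Positive; positive; nonNegative)
  import Data.Integer.Properties as ℤ
  open import Data.Integer.Tactic.RingSolver using (solve-∀)
  open import Algebra.Properties.CommutativeSemigroup ℤ.+-commutativeSemigroup
    using () renaming (interchange to +-interchange)
  open import Algebra.Properties.CommutativeSemigroup ℤ.*-commutativeSemigroup
    using () renaming (interchange to *-interchange)

  ∑ : {A : Set} → List A → (A → ℤ) → ℤ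
  ∑ xs f = foldr _+_ (+ 0) (map f xs)

  infix 7.5 ∑
  syntax ∑ xs (λ x → e) = ∑[ x ∈ xs ] e

  infix 8 _²
  _² : ℤ → ℤ
  i ² = i * i

  module _ {A : Set} where

    ∑-cong : (xs : List A) {f g : A → ℤ} → (∀ x → f x ≡ g x) → ∑ xs f ≡ ∑ xs g
    ∑-cong [] eq = refl
    ∑-cong (x ∷ xs) eq = cong₂ _+_ (eq x) (∑-cong xs eq)

    ∑-mono-≤ : (xs : List A) {f g : A → ℤ} → (∀ x → f x ≤ g x) → ∑ xs f ≤ ∑ xs g
    ∑-mono-≤ [] le = ℤ.≤-refl
    ∑-mono-≤ (x ∷ xs) le = ℤ.+-mono-≤ (le x) (∑-mono-≤ xs le)

    ∑-distrib-+ : (xs : List A) (f g : A → ℤ) → ∑[ x ∈ xs ] (f x + g x) ≡ ∑ xs f + ∑ xs g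
    ∑-distrib-+ [] f g = refl
    ∑-distrib-+ (x ∷ xs) f g = begin
      (f x + g x) + ∑[ y ∈ xs ] (f y + g y) ≡⟨ cong (_+_ (f x + g x)) (∑-distrib-+ xs f g) ⟩
      (f x + g x) + (∑ xs f + ∑ xs g)       ≡⟨ +-interchange (f x) (g x) (∑ xs f) (∑ xs g) ⟩
      (f x + ∑ xs f) + (g x + ∑ xs g)       ∎
      where open ≡-Reasoning

    ∑-*ˡ : (xs : List A) (c : ℤ) (f : A → ℤ) → ∑[ x ∈ xs ] (c * f x) ≡ c * ∑ xs f
    ∑-*ˡ [] c f = sym (ℤ.*-zeroʳ c)
    ∑-*ˡ (x ∷ xs) c f = trans (cong (_+_ (c * f x)) (∑-*ˡ xs c f)) (sym (ℤ.*-distribˡ-+ c (f x) (∑ xs f)))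

    ∑-neg : (xs : List A) (f : A → ℤ) → ∑[ x ∈ xs ] (- f x) ≡ - ∑ xs f
    ∑-neg [] f = refl
    ∑-neg (x ∷ xs) f = trans (cong (_+_ (- f x)) (∑-neg xs f)) (sym (ℤ.neg-distrib-+ (f x) (∑ xs f)))

    ∑-const : (xs : List A) (c : ℤ) → ∑[ _ ∈ xs ] c ≡ c * + length xs
    ∑-const [] c = sym (ℤ.*-zeroʳ c)
    ∑-const (x ∷ xs) c = begin
      c + ∑[ _ ∈ xs ] c          ≡⟨ cong (_+_ c) (∑-const xs c) ⟩
      c + c * + length xs        ≡⟨ cong (_+ c * + length xs) (ℤ.*-identityʳ c) ⟨
      c * + 1 + c * + length xs  ≡⟨ ℤ.*-distribˡ-+ c (+ 1) (+ length xs) ⟨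
      c * + suc (length xs)      ∎
      where open ≡-Reasoning

    ∑-++ : (xs ys : List A) (f : A → ℤ) → ∑ (xs ++ ys) f ≡ ∑ xs f + ∑ ys f
    ∑-++ [] ys f = sym (ℤ.+-identityˡ _)
    ∑-++ (x ∷ xs) ys f = trans (cong (_+_ (f x)) (∑-++ xs ys f)) (sym (ℤ.+-assoc (f x) (∑ xs f) (∑ ys f)))

    ∑-map : {B : Set} (h : B → A) (xs : List B) (f : A → ℤ) → ∑ (map h xs) f ≡ ∑[ x ∈ xs ] f (h x)
    ∑-map h [] f = refl
    ∑-map h (x ∷ xs) f = cong (_+_ (f (h x))) (∑-map h xs f)

  ∑-comm : {A B : Set} (xs : List A) (ys : List B) (f : A → B → ℤ) →
    ∑[ x ∈ xs ] ∑[ y ∈ ys ] f x y ≡ ∑[ y ∈ ys ] ∑[ x ∈ xs ] f x y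
  ∑-comm [] ys f = sym (trans (∑-const ys (+ 0)) (ℤ.*-zeroˡ (+ length ys)))
  ∑-comm (x ∷ xs) ys f =
    trans (cong (_+_ (∑ ys (f x))) (∑-comm xs ys f)) (sym (∑-distrib-+ ys (f x) (λ y → ∑[ x ∈ xs ] f x y)))

  ∑-*-∑ : {A B : Set} (xs : List A) (ys : List B) (f : A → ℤ) (g : B → ℤ) →
    ∑ xs f * ∑ ys g ≡ ∑[ x ∈ xs ] ∑[ y ∈ ys ] (f x * g y)
  ∑-*-∑ xs ys f g = begin
    ∑ xs f * ∑ ys g                 ≡⟨ ℤ.*-comm (∑ xs f) (∑ ys g) ⟩
    ∑ ys g * ∑ xs f                 ≡⟨ ∑-*ˡ xs (∑ ys g) f ⟨
    ∑[ x ∈ xs ] (∑ ys g * f x)      ≡⟨ ∑-cong xs (λ x → ℤ.*-comm (∑ ys g) (f x)) ⟩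
    ∑[ x ∈ xs ] (f x * ∑ ys g)      ≡⟨ ∑-cong xs (λ x → ∑-*ˡ ys (f x) g) ⟨
    ∑[ x ∈ xs ] ∑[ y ∈ ys ] (f x * g y) ∎
    where open ≡-Reasoning

  ∑-cartesianProduct : {A B : Set} (xs : List A) (ys : List B) (f : A × B → ℤ) →
    ∑ (cartesianProduct xs ys) f ≡ ∑[ x ∈ xs ] ∑[ y ∈ ys ] f (x , y)
  ∑-cartesianProduct [] ys f = refl
  ∑-cartesianProduct (x ∷ xs) ys f = begin
    ∑ (map (x ,_) ys ++ cartesianProduct xs ys) f
      ≡⟨ ∑-++ (map (x ,_) ys) (cartesianProduct xs ys) f ⟩
    ∑ (map (x ,_) ys) f + ∑ (cartesianProduct xs ys) f
      ≡⟨ cong₂ _+_ (∑-map (x ,_) ys f) (∑-cartesianProduct xs ys f) ⟩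
    ∑[ y ∈ ys ] f (x , y) + ∑[ x′ ∈ xs ] ∑[ y ∈ ys ] f (x′ , y) ∎
    where open ≡-Reasoning

  𝟙 : {P : Set} → Dec P → ℤ
  𝟙 (yes _) = + 1
  𝟙 (no _) = + 0

  length-filter≡∑𝟙 : {A : Set} {P : A → Set} (P? : ∀ x → Dec (P x)) (xs : List A) →
    + length (filter P? xs) ≡ ∑[ x ∈ xs ] 𝟙 (P? x)
  length-filter≡∑𝟙 P? [] = refl
  length-filter≡∑𝟙 P? (x ∷ xs) with P? x
  ... | yes _ = cong (_+_ (+ 1)) (length-filter≡∑𝟙 P? xs)
  ... | no _ = trans (length-filter≡∑𝟙 P? xs) (sym (ℤ.+-identityˡ _))

  δ : ∀ {n} → 𝔽₂^ n → 𝔽₂^ n → ℤ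
  δ x y = 𝟙 (x ≟v y)

  δ-refl : ∀ {n} (x : 𝔽₂^ n) → δ x x ≡ + 1
  δ-refl x with x ≟v x
  ... | yes _ = refl
  ... | no x≢x = ⊥-elim (x≢x refl)

  δ-≢ : ∀ {n} {x y : 𝔽₂^ n} → ¬ x ≡ y → δ x y ≡ + 0
  δ-≢ {x = x} {y} x≢y with x ≟v y
  ... | yes x≡y = ⊥-elim (x≢y x≡y)
  ... | no _ = refl

  δ-cong-⇔ : ∀ {n m} {x y : 𝔽₂^ n} {u v : 𝔽₂^ m} → (x ≡ y → u ≡ v) → (u ≡ v → x ≡ y) → δ x y ≡ δ u v
  δ-cong-⇔ {x = x} {y} {u} {v} to from with x ≟v y | u ≟v v
  ... | yes _ | yes _ = refl
  ... | no _ | no _ = refl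
  ... | yes x≡y | no u≢v = ⊥-elim (u≢v (to x≡y))
  ... | no x≢y | yes u≡v = ⊥-elim (x≢y (from u≡v))

  δ-sym : ∀ {n} (x y : 𝔽₂^ n) → δ x y ≡ δ y x
  δ-sym x y = δ-cong-⇔ sym sym

  δ-∷-same : ∀ {n} (a : Bool) (x y : 𝔽₂^ n) → δ (a ∷ x) (a ∷ y) ≡ δ x y
  δ-∷-same a x y = δ-cong-⇔ ∷-injectiveʳ (cong (a ∷_))

  δ-∷ : ∀ {n} (a b : Bool) (x y : 𝔽₂^ n) → δ (a ∷ x) (b ∷ y) ≡ 𝟙 (a Bool.≟ b) * δ x y
  δ-∷ false false x y = trans (δ-∷-same false x y) (sym (ℤ.*-identityˡ (δ x y)))
  δ-∷ true true x y = trans (δ-∷-same true x y) (sym (ℤ.*-identityˡ (δ x y)))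
  δ-∷ false true x y = δ-≢ {x = false ∷ x} {true ∷ y} (λ ())
  δ-∷ true false x y = δ-≢ {x = true ∷ x} {false ∷ y} (λ ())

  N : ℕ → ℤ
  N n = + (2 ^ n)

  N-suc : ∀ n → N (suc n) ≡ N n + N n
  N-suc n = cong (λ k → + (2 ^ n ℕ.+ k)) (ℕ.*-identityˡ (2 ^ n))

  N-positive : ∀ n → Positive (N n)
  N-positive n = positive (+<+ (ℕ.m^n>0 2 n))

  0≤N*N : ∀ n → + 0 ≤ N n * N n
  0≤N*N n = subst (+ 0 ≤_) (ℤ.pos-* (2 ^ n) (2 ^ n)) (+≤+ ℕ.z≤n)

  length-allVecs : ∀ n → length (allVecs n) ≡ 2 ^ n
  length-allVecs zero = refl
  length-allVecs (suc n) = begin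
    length (map (false ∷_) (allVecs n) ++ map (true ∷_) (allVecs n))
      ≡⟨ length-++ (map (false ∷_) (allVecs n)) ⟩
    length (map (false ∷_) (allVecs n)) ℕ.+ length (map (true ∷_) (allVecs n))
      ≡⟨ cong₂ ℕ._+_ (length-map (false ∷_) (allVecs n)) (length-map (true ∷_) (allVecs n)) ⟩
    length (allVecs n) ℕ.+ length (allVecs n)
      ≡⟨ cong₂ ℕ._+_ (length-allVecs n) (trans (length-allVecs n) (sym (ℕ.+-identityʳ (2 ^ n)))) ⟩
    2 ^ n ℕ.+ (2 ^ n ℕ.+ 0) ∎
    where open ≡-Reasoning

  ∑-allVecs-const : ∀ n (c : ℤ) → ∑[ _ ∈ allVecs n ] c ≡ c * N n
  ∑-allVecs-const n c = trans (∑-const (allVecs n) c) (cong (λ k → c * + k) (length-allVecs n))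

  ∑-allVecs-suc : ∀ {n} (f : 𝔽₂^ (suc n) → ℤ) →
    ∑ (allVecs (suc n)) f ≡ ∑[ x ∈ allVecs n ] f (false ∷ x) + ∑[ x ∈ allVecs n ] f (true ∷ x)
  ∑-allVecs-suc {n} f = trans (∑-++ (map (false ∷_) (allVecs n)) (map (true ∷_) (allVecs n)) f)
    (cong₂ _+_ (∑-map (false ∷_) (allVecs n) f) (∑-map (true ∷_) (allVecs n) f))

  ∑-δ-* : ∀ n (u : 𝔽₂^ n) (g : 𝔽₂^ n → ℤ) → ∑[ y ∈ allVecs n ] (δ u y * g y) ≡ g u
  ∑-δ-* zero [] g = trans (ℤ.+-identityʳ _) (ℤ.*-identityˡ (g []))
  ∑-δ-* (suc n) (a ∷ u) g = begin
    ∑[ y ∈ allVecs (suc n) ] (δ (a ∷ u) y * g y)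
      ≡⟨ ∑-allVecs-suc (λ y → δ (a ∷ u) y * g y) ⟩
    ∑[ y ∈ allVecs n ] (δ (a ∷ u) (false ∷ y) * g (false ∷ y)) + ∑[ y ∈ allVecs n ] (δ (a ∷ u) (true ∷ y) * g (true ∷ y))
      ≡⟨ cong₂ _+_ (sift false) (sift true) ⟩
    𝟙 (a Bool.≟ false) * g (false ∷ u) + 𝟙 (a Bool.≟ true) * g (true ∷ u)
      ≡⟨ pick a ⟩
    g (a ∷ u) ∎
    where
    open ≡-Reasoning
    sift : ∀ b → ∑[ y ∈ allVecs n ] (δ (a ∷ u) (b ∷ y) * g (b ∷ y)) ≡ 𝟙 (a Bool.≟ b) * g (b ∷ u)
    sift b = begin
      ∑[ y ∈ allVecs n ] (δ (a ∷ u) (b ∷ y) * g (b ∷ y))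
        ≡⟨ ∑-cong (allVecs n) (λ y → trans (cong (_* g (b ∷ y)) (δ-∷ a b u y))
                                           (ℤ.*-assoc (𝟙 (a Bool.≟ b)) (δ u y) (g (b ∷ y)))) ⟩
      ∑[ y ∈ allVecs n ] (𝟙 (a Bool.≟ b) * (δ u y * g (b ∷ y)))
        ≡⟨ ∑-*ˡ (allVecs n) (𝟙 (a Bool.≟ b)) (λ y → δ u y * g (b ∷ y)) ⟩
      𝟙 (a Bool.≟ b) * ∑[ y ∈ allVecs n ] (δ u y * g (b ∷ y))
        ≡⟨ cong (_*_ (𝟙 (a Bool.≟ b))) (∑-δ-* n u (λ y → g (b ∷ y))) ⟩
      𝟙 (a Bool.≟ b) * g (b ∷ u) ∎
    pick : ∀ a → 𝟙 (a Bool.≟ false) * g (false ∷ u) + 𝟙 (a Bool.≟ true) * g (true ∷ u) ≡ g (a ∷ u)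
    pick false = trans (cong₂ _+_ (ℤ.*-identityˡ (g (false ∷ u))) (ℤ.*-zeroˡ (g (true ∷ u)))) (ℤ.+-identityʳ (g (false ∷ u)))
    pick true = trans (cong₂ _+_ (ℤ.*-zeroˡ (g (false ∷ u))) (ℤ.*-identityˡ (g (true ∷ u)))) (ℤ.+-identityˡ (g (true ∷ u)))

  ∑-δ : ∀ n (u : 𝔽₂^ n) → ∑[ y ∈ allVecs n ] δ u y ≡ + 1
  ∑-δ n u = trans (∑-cong (allVecs n) (λ y → sym (ℤ.*-identityʳ (δ u y)))) (∑-δ-* n u (λ _ → + 1))

  -- Characters and orthogonal systems

  sgn-xor : ∀ u v → sgn (u xor v) ≡ sgn u * sgn v
  sgn-xor false v = sym (ℤ.*-identityˡ (sgn v))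
  sgn-xor true false = refl
  sgn-xor true true = refl

  χ : ∀ {n} → 𝔽₂^ n → 𝔽₂^ n → ℤ
  χ a x = sgn ⟨ a , x ⟩

  χ-⊕ : ∀ {n} (a x y : 𝔽₂^ n) → χ a (x ⊕ y) ≡ χ a x * χ a y
  χ-⊕ a x y = trans (cong sgn (⟨⟩-distribʳ-⊕ a x y)) (sgn-xor ⟨ a , x ⟩ ⟨ a , y ⟩)

  ∑-χ : ∀ n (c : 𝔽₂^ n) → ∑[ a ∈ allVecs n ] χ a c ≡ N n * δ c 𝟎
  ∑-χ zero [] = refl
  ∑-χ (suc n) (false ∷ c) = begin
    ∑[ a ∈ allVecs (suc n) ] χ a (false ∷ c)           ≡⟨ ∑-allVecs-suc (λ a → χ a (false ∷ c)) ⟩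
    ∑[ a ∈ allVecs n ] χ a c + ∑[ a ∈ allVecs n ] χ a c ≡⟨ cong₂ _+_ (∑-χ n c) (∑-χ n c) ⟩
    N n * δ c 𝟎 + N n * δ c 𝟎                         ≡⟨ ℤ.*-distribʳ-+ (δ c 𝟎) (N n) (N n) ⟨
    (N n + N n) * δ c 𝟎                               ≡⟨ cong₂ _*_ (N-suc n) (δ-∷-same false c 𝟎) ⟨
    N (suc n) * δ (false ∷ c) 𝟎                       ∎
    where open ≡-Reasoning
  ∑-χ (suc n) (true ∷ c) = begin
    ∑[ a ∈ allVecs (suc n) ] χ a (true ∷ c)
      ≡⟨ ∑-allVecs-suc (λ a → χ a (true ∷ c)) ⟩
    ∑[ a ∈ allVecs n ] χ a c + ∑[ a ∈ allVecs n ] sgn (not ⟨ a , c ⟩)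
      ≡⟨ cong (_+_ (∑[ a ∈ allVecs n ] χ a c))
              (trans (∑-cong (allVecs n) (λ a → sgn-not ⟨ a , c ⟩)) (∑-neg (allVecs n) (λ a → χ a c))) ⟩
    ∑[ a ∈ allVecs n ] χ a c - ∑[ a ∈ allVecs n ] χ a c
      ≡⟨ ℤ.+-inverseʳ (∑[ a ∈ allVecs n ] χ a c) ⟩
    + 0
      ≡⟨ ℤ.*-zeroʳ (N (suc n)) ⟨
    N (suc n) * + 0 ∎
    where
    open ≡-Reasoning
    sgn-not : ∀ b → sgn (not b) ≡ - sgn b
    sgn-not false = refl
    sgn-not true = refl

  record Orthogonal {V K : Set} (vs : List V) (e : V → K → ℤ) (Δ : K → K → ℤ) (M : ℤ) : Set where
    constructor orthogonal
    field ∑-* : ∀ k l → ∑[ v ∈ vs ] (e v k * e v l) ≡ M * Δ k l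

  χ-orthogonal : ∀ n → Orthogonal (allVecs n) χ δ (N n)
  χ-orthogonal n = orthogonal λ k k′ → begin
    ∑[ a ∈ allVecs n ] (χ a k * χ a k′) ≡⟨ ∑-cong (allVecs n) (λ a → χ-⊕ a k k′) ⟨
    ∑[ a ∈ allVecs n ] χ a (k ⊕ k′)     ≡⟨ ∑-χ n (k ⊕ k′) ⟩
    N n * δ (k ⊕ k′) 𝟎                  ≡⟨ cong (N n *_) (δ-cong-⇔ (⊕≡𝟎⇒≡ k k′) (λ { refl → ⊕-self k })) ⟩
    N n * δ k k′                        ∎
    where open ≡-Reasoning

  _⊗_ : {A B C D : Set} → (A → C → ℤ) → (B → D → ℤ) → A × B → C × D → ℤ
  (e ⊗ e′) (a , b) (c , d) = e a c * e′ b d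

  ⊗-orthogonal : ∀ {V V′ K K′ : Set} {vs : List V} {vs′ : List V′}
    {e : V → K → ℤ} {e′ : V′ → K′ → ℤ} {Δ : K → K → ℤ} {Δ′ : K′ → K′ → ℤ} {M M′ : ℤ} →
    Orthogonal vs e Δ M → Orthogonal vs′ e′ Δ′ M′ →
    Orthogonal (cartesianProduct vs vs′) (e ⊗ e′) (Δ ⊗ Δ′) (M * M′)
  ⊗-orthogonal {vs = vs} {vs′} {e} {e′} {Δ} {Δ′} {M} {M′} (orthogonal orth) (orthogonal orth′) =
    orthogonal λ { (k , k′) (l , l′) → product k k′ l l′ }
    where
    open ≡-Reasoning
    product : ∀ k k′ l l′ → ∑[ v ∈ cartesianProduct vs vs′ ] ((e ⊗ e′) v (k , k′) * (e ⊗ e′) v (l , l′))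
                            ≡ (M * M′) * (Δ ⊗ Δ′) (k , k′) (l , l′)
    product k k′ l l′ = begin
      ∑[ v ∈ cartesianProduct vs vs′ ] ((e ⊗ e′) v (k , k′) * (e ⊗ e′) v (l , l′))
        ≡⟨ ∑-cartesianProduct vs vs′ _ ⟩
      ∑[ v ∈ vs ] ∑[ v′ ∈ vs′ ] ((e v k * e′ v′ k′) * (e v l * e′ v′ l′))
        ≡⟨ ∑-cong vs (λ v → ∑-cong vs′ (λ v′ → *-interchange (e v k) (e′ v′ k′) (e v l) (e′ v′ l′))) ⟩
      ∑[ v ∈ vs ] ∑[ v′ ∈ vs′ ] ((e v k * e v l) * (e′ v′ k′ * e′ v′ l′))
        ≡⟨ ∑-*-∑ vs vs′ _ _ ⟨
      ∑[ v ∈ vs ] (e v k * e v l) * ∑[ v′ ∈ vs′ ] (e′ v′ k′ * e′ v′ l′)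
        ≡⟨ cong₂ _*_ (orth k l) (orth′ k′ l′) ⟩
      (M * Δ k l) * (M′ * Δ′ k′ l′)
        ≡⟨ *-interchange M (Δ k l) M′ (Δ′ k′ l′) ⟩
      (M * M′) * (Δ k l * Δ′ k′ l′) ∎

  module _ {V K : Set} {vs : List V} {e : V → K → ℤ} {Δ : K → K → ℤ} {M : ℤ}
           (e-orthogonal : Orthogonal vs e Δ M) where

    plancherel : {X : Set} (xs : List X) (w : X → ℤ) (u : X → K) →
      ∑[ v ∈ vs ] (∑[ x ∈ xs ] (w x * e v (u x))) ² ≡ M * ∑[ x ∈ xs ] ∑[ y ∈ xs ] (w x * w y * Δ (u x) (u y))
    plancherel xs w u = begin
      ∑[ v ∈ vs ] (∑[ x ∈ xs ] (w x * e v (u x))) ²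
        ≡⟨ ∑-cong vs (λ v → ∑-*-∑ xs xs (λ x → w x * e v (u x)) (λ y → w y * e v (u y))) ⟩
      ∑[ v ∈ vs ] ∑[ x ∈ xs ] ∑[ y ∈ xs ] ((w x * e v (u x)) * (w y * e v (u y)))
        ≡⟨ trans (∑-comm vs xs _) (∑-cong xs (λ x → ∑-comm vs xs _)) ⟩
      ∑[ x ∈ xs ] ∑[ y ∈ xs ] ∑[ v ∈ vs ] ((w x * e v (u x)) * (w y * e v (u y)))
        ≡⟨ ∑-cong xs (λ x → ∑-cong xs (λ y → pair x y)) ⟩
      ∑[ x ∈ xs ] ∑[ y ∈ xs ] (M * (w x * w y * Δ (u x) (u y)))
        ≡⟨ trans (∑-cong xs (λ x → ∑-*ˡ xs M _)) (∑-*ˡ xs M _) ⟩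
      M * ∑[ x ∈ xs ] ∑[ y ∈ xs ] (w x * w y * Δ (u x) (u y)) ∎
      where
      open ≡-Reasoning
      rotate : ∀ a b m d → a * b * (m * d) ≡ m * (a * b * d)
      rotate = solve-∀
      pair : ∀ x y → ∑[ v ∈ vs ] ((w x * e v (u x)) * (w y * e v (u y))) ≡ M * (w x * w y * Δ (u x) (u y))
      pair x y = begin
        ∑[ v ∈ vs ] ((w x * e v (u x)) * (w y * e v (u y)))
          ≡⟨ ∑-cong vs (λ v → *-interchange (w x) (e v (u x)) (w y) (e v (u y))) ⟩
        ∑[ v ∈ vs ] (w x * w y * (e v (u x) * e v (u y)))
          ≡⟨ ∑-*ˡ vs (w x * w y) _ ⟩
        w x * w y * ∑[ v ∈ vs ] (e v (u x) * e v (u y))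
          ≡⟨ cong (w x * w y *_) (Orthogonal.∑-* e-orthogonal (u x) (u y)) ⟩
        w x * w y * (M * Δ (u x) (u y))
          ≡⟨ rotate (w x) (w y) M (Δ (u x) (u y)) ⟩
        M * (w x * w y * Δ (u x) (u y)) ∎

    plancherel₁ : {X : Set} (xs : List X) (u : X → K) →
      ∑[ v ∈ vs ] (∑[ x ∈ xs ] e v (u x)) ² ≡ M * ∑[ x ∈ xs ] ∑[ y ∈ xs ] Δ (u x) (u y)
    plancherel₁ xs u = begin
      ∑[ v ∈ vs ] (∑[ x ∈ xs ] e v (u x)) ²
        ≡⟨ ∑-cong vs (λ v → cong _² (∑-cong xs (λ x → sym (ℤ.*-identityˡ (e v (u x)))))) ⟩
      ∑[ v ∈ vs ] (∑[ x ∈ xs ] (+ 1 * e v (u x))) ²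
        ≡⟨ plancherel xs (λ _ → + 1) u ⟩
      M * ∑[ x ∈ xs ] ∑[ y ∈ xs ] (+ 1 * + 1 * Δ (u x) (u y))
        ≡⟨ cong (M *_) (∑-cong xs (λ x → ∑-cong xs (λ y → ℤ.*-identityˡ (Δ (u x) (u y))))) ⟩
      M * ∑[ x ∈ xs ] ∑[ y ∈ xs ] Δ (u x) (u y) ∎
      where open ≡-Reasoning

  -- The Walsh transform

  walsh≡∑ : ∀ {n} (f : 𝔽₂^ n → Bool) (a : 𝔽₂^ n) → walsh f a ≡ ∑[ x ∈ allVecs n ] (sgn (f x) * χ a x)
  walsh≡∑ {n} f a = ∑-cong (allVecs n) (λ x → sgn-xor (f x) ⟨ a , x ⟩)

  walsh-at-𝟎 : ∀ {n} (f : 𝔽₂^ n → Bool) → walsh f 𝟎 ≡ ∑[ x ∈ allVecs n ] sgn (f x)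
  walsh-at-𝟎 {n} f = ∑-cong (allVecs n) λ x →
    trans (cong (λ t → sgn (f x xor t)) (⟨𝟎,⟩≡false x)) (cong sgn (xor-identityʳ (f x)))

  balanced⇒walsh-at-𝟎≡0 : ∀ n (f : 𝔽₂^ (suc n) → Bool) → IsBalanced f → walsh f 𝟎 ≡ + 0
  balanced⇒walsh-at-𝟎≡0 n f balanced = begin
    walsh f 𝟎
      ≡⟨ walsh-at-𝟎 f ⟩
    ∑[ x ∈ allVecs (suc n) ] sgn (f x)
      ≡⟨ ∑-cong (allVecs (suc n)) (λ x → sgn≡2𝟙-1 (f x)) ⟩
    ∑[ x ∈ allVecs (suc n) ] (+ 2 * 𝟙 (f x Bool.≟ false) - + 1)
      ≡⟨ ∑-distrib-+ (allVecs (suc n)) _ _ ⟩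
    ∑[ x ∈ allVecs (suc n) ] (+ 2 * 𝟙 (f x Bool.≟ false)) + ∑[ x ∈ allVecs (suc n) ] - + 1
      ≡⟨ cong₂ _+_ (∑-*ˡ (allVecs (suc n)) (+ 2) _) (∑-neg (allVecs (suc n)) (λ _ → + 1)) ⟩
    + 2 * ∑[ x ∈ allVecs (suc n) ] 𝟙 (f x Bool.≟ false) - ∑[ x ∈ allVecs (suc n) ] + 1
      ≡⟨ cong₂ (λ c t → + 2 * c - t) (length-filter≡∑𝟙 (λ x → f x Bool.≟ false) (allVecs (suc n)))
                                     (sym (∑-allVecs-const (suc n) (+ 1))) ⟨
    + 2 * + count (λ x → f x Bool.≟ false) - + 1 * N (suc n)
      ≡⟨ cong₂ (λ c t → + 2 * + c - t) balanced (ℤ.*-identityˡ (N (suc n))) ⟩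
    + 2 * N n - N (suc n)
      ≡⟨ cong (_- N (suc n)) (ℤ.pos-* 2 (2 ^ n)) ⟨
    N (suc n) - N (suc n)
      ≡⟨ ℤ.+-inverseʳ (N (suc n)) ⟩
    + 0 ∎
    where
    open ≡-Reasoning
    sgn≡2𝟙-1 : ∀ b → sgn b ≡ + 2 * 𝟙 (b Bool.≟ false) - + 1
    sgn≡2𝟙-1 false = refl
    sgn≡2𝟙-1 true = refl

  parseval : ∀ n (f : 𝔽₂^ n → Bool) → ∑[ a ∈ allVecs n ] walsh f a ² ≡ N n * N n
  parseval n f = begin
    ∑[ a ∈ allVecs n ] walsh f a ²
      ≡⟨ ∑-cong (allVecs n) (λ a → cong _² (walsh≡∑ f a)) ⟩
    ∑[ a ∈ allVecs n ] (∑[ x ∈ allVecs n ] (sgn (f x) * χ a x)) ²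
      ≡⟨ plancherel (χ-orthogonal n) (allVecs n) (sgn ∘ f) id ⟩
    N n * ∑[ x ∈ allVecs n ] ∑[ y ∈ allVecs n ] (sgn (f x) * sgn (f y) * δ x y)
      ≡⟨ cong (N n *_) (∑-cong (allVecs n) diagonal) ⟩
    N n * ∑[ x ∈ allVecs n ] + 1
      ≡⟨ cong (N n *_) (trans (∑-allVecs-const n (+ 1)) (ℤ.*-identityˡ (N n))) ⟩
    N n * N n ∎
    where
    open ≡-Reasoning
    sgn² : ∀ u → sgn u ² ≡ + 1
    sgn² false = refl
    sgn² true = refl
    diagonal : ∀ x → ∑[ y ∈ allVecs n ] (sgn (f x) * sgn (f y) * δ x y) ≡ + 1
    diagonal x = begin
      ∑[ y ∈ allVecs n ] (sgn (f x) * sgn (f y) * δ x y)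
        ≡⟨ ∑-cong (allVecs n) (λ y → ℤ.*-comm (sgn (f x) * sgn (f y)) (δ x y)) ⟩
      ∑[ y ∈ allVecs n ] (δ x y * (sgn (f x) * sgn (f y)))
        ≡⟨ ∑-δ-* n x (λ y → sgn (f x) * sgn (f y)) ⟩
      sgn (f x) ²
        ≡⟨ sgn² (f x) ⟩
      + 1 ∎

  collisions : ∀ {n m} → (𝔽₂^ n → 𝔽₂^ m) → ℤ
  collisions {n} F = ∑[ x ∈ allVecs n ] ∑[ y ∈ allVecs n ] δ (F x) (F y)

  ∑-walsh-at-𝟎² : ∀ {n m} (F : 𝔽₂^ n → 𝔽₂^ m) →
    ∑[ b ∈ allVecs m ] walsh (component F b) 𝟎 ² ≡ N m * collisions F
  ∑-walsh-at-𝟎² {n} {m} F = trans (∑-cong (allVecs m) (λ b → cong _² (walsh-at-𝟎 (component F b))))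
    (plancherel₁ (χ-orthogonal m) (allVecs n) F)

  walsh-component-𝟎 : ∀ {n m} (F : 𝔽₂^ n → 𝔽₂^ m) (a : 𝔽₂^ n) → walsh (component F 𝟎) a ≡ N n * δ a 𝟎
  walsh-component-𝟎 {n} F a = trans (∑-cong (allVecs n) λ x →
    trans (cong (λ t → sgn (t xor ⟨ a , x ⟩)) (⟨𝟎,⟩≡false (F x))) (cong sgn (⟨⟩-comm a x))) (∑-χ n a)

  -- IsPlateauedWith without its parity condition n + t ≡ 2 * h, which the argument never uses.
  record HasAmplitude {n} (h : ℕ) (f : 𝔽₂^ n → Bool) : Set where
    constructor amplitude
    field ∣walsh∣∈ : ∀ a → (∣ walsh f a ∣ ≡ 0) ⊎ (∣ walsh f a ∣ ≡ 2 ^ h)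

  Λ : ℕ → ℤ
  Λ h = + (2 ^ h ℕ.* 2 ^ h)

  i²≡∣i∣*∣i∣ : ∀ i → i ² ≡ + (∣ i ∣ ℕ.* ∣ i ∣)
  i²≡∣i∣*∣i∣ (+ k) = sym (ℤ.pos-* k k)
  i²≡∣i∣*∣i∣ -[1+ k ] = refl

  module _ {n h} {f : 𝔽₂^ n → Bool} (f-amplitude : HasAmplitude h f) where

    walsh²∈ : ∀ a → (walsh f a ² ≡ + 0) ⊎ (walsh f a ² ≡ Λ h)
    walsh²∈ a with HasAmplitude.∣walsh∣∈ f-amplitude a
    ... | inj₁ eq = inj₁ (trans (i²≡∣i∣*∣i∣ (walsh f a)) (cong (λ k → + (k ℕ.* k)) eq))
    ... | inj₂ eq = inj₂ (trans (i²≡∣i∣*∣i∣ (walsh f a)) (cong (λ k → + (k ℕ.* k)) eq))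

    walsh²≤Λ : ∀ a → walsh f a ² ≤ Λ h
    walsh²≤Λ a with walsh²∈ a
    ... | inj₁ eq rewrite eq = +≤+ ℕ.z≤n
    ... | inj₂ eq rewrite eq = ℤ.≤-refl

    ∑-walsh⁴≡Λ*N² : ∑[ a ∈ allVecs n ] (walsh f a ²) ² ≡ Λ h * (N n * N n)
    ∑-walsh⁴≡Λ*N² = begin
      ∑[ a ∈ allVecs n ] (walsh f a ²) ²  ≡⟨ ∑-cong (allVecs n) (λ a → square (walsh²∈ a)) ⟩
      ∑[ a ∈ allVecs n ] (Λ h * walsh f a ²) ≡⟨ ∑-*ˡ (allVecs n) (Λ h) (λ a → walsh f a ²) ⟩
      Λ h * ∑[ a ∈ allVecs n ] walsh f a ² ≡⟨ cong (Λ h *_) (parseval n f) ⟩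
      Λ h * (N n * N n) ∎
      where
      open ≡-Reasoning
      square : ∀ {w} → (w ≡ + 0) ⊎ (w ≡ Λ h) → w ² ≡ Λ h * w
      square (inj₁ refl) = sym (ℤ.*-zeroʳ (Λ h))
      square (inj₂ refl) = refl

    unbiased⇒2^n<Λ : walsh f 𝟎 ≡ + 0 → 2 ^ n ℕ.< 2 ^ h ℕ.* 2 ^ h
    unbiased⇒2^n<Λ unbiased =
      ℕ.*-cancelʳ-< (2 ^ n) (2 ^ n) L (ℕ.<-≤-trans (ℕ.m<m+n (2 ^ n ℕ.* 2 ^ n) L>0) (ℤ.drop‿+≤+ sum≤′))
      where
      L : ℕ
      L = 2 ^ h ℕ.* 2 ^ h
      L>0 : 0 ℕ.< L
      L>0 = subst (0 ℕ.<_) (ℕ.^-distribˡ-+-* 2 h h) (ℕ.m^n>0 2 (h ℕ.+ h))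
      pointwise : ∀ a → walsh f a ² + δ 𝟎 a * Λ h ≤ Λ h
      pointwise a with 𝟎 ≟v a
      ... | yes refl = ℤ.≤-reflexive (begin
        walsh f 𝟎 ² + + 1 * Λ h ≡⟨ cong (λ w → w ² + + 1 * Λ h) unbiased ⟩
        + 0 + + 1 * Λ h         ≡⟨ trans (ℤ.+-identityˡ (+ 1 * Λ h)) (ℤ.*-identityˡ (Λ h)) ⟩
        Λ h                     ∎)
        where open ≡-Reasoning
      ... | no _ = subst (_≤ Λ h) (sym (trans (cong (walsh f a ² +_) (ℤ.*-zeroˡ (Λ h))) (ℤ.+-identityʳ (walsh f a ²)))) (walsh²≤Λ a)
      sum≤ : N n * N n + Λ h ≤ Λ h * N n
      sum≤ = begin
        N n * N n + Λ h
          ≡⟨ cong₂ _+_ (parseval n f) (∑-δ-* n 𝟎 (λ _ → Λ h)) ⟨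
        ∑[ a ∈ allVecs n ] walsh f a ² + ∑[ a ∈ allVecs n ] (δ 𝟎 a * Λ h)
          ≡⟨ ∑-distrib-+ (allVecs n) _ _ ⟨
        ∑[ a ∈ allVecs n ] (walsh f a ² + δ 𝟎 a * Λ h)
          ≤⟨ ∑-mono-≤ (allVecs n) pointwise ⟩
        ∑[ a ∈ allVecs n ] Λ h
          ≡⟨ ∑-allVecs-const n (Λ h) ⟩
        Λ h * N n ∎
        where open ℤ.≤-Reasoning
      sum≤′ : + (2 ^ n ℕ.* 2 ^ n ℕ.+ L) ≤ + (L ℕ.* 2 ^ n)
      sum≤′ = subst₂ _≤_ (cong (_+ Λ h) (sym (ℤ.pos-* (2 ^ n) (2 ^ n)))) (sym (ℤ.pos-* L (2 ^ n))) sum≤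

  component-𝟎-amplitude : ∀ {n m} (F : 𝔽₂^ n → 𝔽₂^ m) → HasAmplitude n (component F 𝟎)
  component-𝟎-amplitude {n} F = amplitude values
    where
    values : ∀ a → (∣ walsh (component F 𝟎) a ∣ ≡ 0) ⊎ (∣ walsh (component F 𝟎) a ∣ ≡ 2 ^ n)
    values a with a ≟v 𝟎
    ... | yes refl = inj₂ (cong ∣_∣ (trans (walsh-component-𝟎 F 𝟎) (trans (cong (N n *_) (δ-refl 𝟎)) (ℤ.*-identityʳ (N n)))))
    ... | no a≢𝟎 = inj₁ (cong ∣_∣ (trans (walsh-component-𝟎 F a) (trans (cong (N n *_) (δ-≢ a≢𝟎)) (ℤ.*-zeroʳ (N n)))))

  plateaued⇒amplitudes : ∀ {n} {F : 𝔽₂^ n → 𝔽₂^ n} → IsPlateaued F → ∀ b → ∃ λ h → HasAmplitude h (component F b)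
  plateaued⇒amplitudes {F = F} plateaued b with b ≟v 𝟎
  ... | yes refl = _ , component-𝟎-amplitude F
  ... | no b≢𝟎 with plateaued b b≢𝟎
  ...   | _ , h , _ , values = h , amplitude values

  -- Fourth moments and additive quadruples

  allPairs : ∀ n → List (𝔽₂^ n × 𝔽₂^ n)
  allPairs n = cartesianProduct (allVecs n) (allVecs n)

  difference : ∀ {n m} → (𝔽₂^ n → 𝔽₂^ m) → 𝔽₂^ n × 𝔽₂^ n → 𝔽₂^ n × 𝔽₂^ m
  difference F (x , y) = x ⊕ y , F x ⊕ F y

  quadruples : ∀ {n m} → (𝔽₂^ n → 𝔽₂^ m) → ℤ
  quadruples {n} F = ∑[ p ∈ allPairs n ] ∑[ q ∈ allPairs n ] (δ ⊗ δ) (difference F p) (difference F q)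

  walsh²≡∑-difference : ∀ {n m} (F : 𝔽₂^ n → 𝔽₂^ m) (a : 𝔽₂^ n) (b : 𝔽₂^ m) →
    walsh (component F b) a ² ≡ ∑[ p ∈ allPairs n ] (χ ⊗ χ) (a , b) (difference F p)
  walsh²≡∑-difference {n} F a b = begin
    walsh (component F b) a ²
      ≡⟨ cong _² (walsh≡∑ (component F b) a) ⟩
    (∑[ x ∈ allVecs n ] (χ b (F x) * χ a x)) ²
      ≡⟨ ∑-*-∑ (allVecs n) (allVecs n) _ _ ⟩
    ∑[ x ∈ allVecs n ] ∑[ y ∈ allVecs n ] ((χ b (F x) * χ a x) * (χ b (F y) * χ a y))
      ≡⟨ ∑-cong (allVecs n) (λ x → ∑-cong (allVecs n) (λ y → pair x y)) ⟩
    ∑[ x ∈ allVecs n ] ∑[ y ∈ allVecs n ] (χ ⊗ χ) (a , b) (difference F (x , y))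
      ≡⟨ ∑-cartesianProduct (allVecs n) (allVecs n) _ ⟨
    ∑[ p ∈ allPairs n ] (χ ⊗ χ) (a , b) (difference F p) ∎
    where
    open ≡-Reasoning
    pair : ∀ x y → (χ b (F x) * χ a x) * (χ b (F y) * χ a y) ≡ χ a (x ⊕ y) * χ b (F x ⊕ F y)
    pair x y = begin
      (χ b (F x) * χ a x) * (χ b (F y) * χ a y) ≡⟨ *-interchange (χ b (F x)) (χ a x) (χ b (F y)) (χ a y) ⟩
      (χ b (F x) * χ b (F y)) * (χ a x * χ a y) ≡⟨ ℤ.*-comm (χ b (F x) * χ b (F y)) (χ a x * χ a y) ⟩
      (χ a x * χ a y) * (χ b (F x) * χ b (F y)) ≡⟨ cong₂ _*_ (χ-⊕ a x y) (χ-⊕ b (F x) (F y)) ⟨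
      χ a (x ⊕ y) * χ b (F x ⊕ F y)             ∎

  ∑-walsh⁴≡quadruples : ∀ {n m} (F : 𝔽₂^ n → 𝔽₂^ m) →
    ∑[ b ∈ allVecs m ] ∑[ a ∈ allVecs n ] (walsh (component F b) a ²) ² ≡ (N n * N m) * quadruples F
  ∑-walsh⁴≡quadruples {n} {m} F = begin
    ∑[ b ∈ allVecs m ] ∑[ a ∈ allVecs n ] (walsh (component F b) a ²) ²
      ≡⟨ ∑-comm (allVecs m) (allVecs n) _ ⟩
    ∑[ a ∈ allVecs n ] ∑[ b ∈ allVecs m ] (walsh (component F b) a ²) ²
      ≡⟨ ∑-cong (allVecs n) (λ a → ∑-cong (allVecs m) (λ b → cong _² (walsh²≡∑-difference F a b))) ⟩
    ∑[ a ∈ allVecs n ] ∑[ b ∈ allVecs m ] (∑[ p ∈ allPairs n ] (χ ⊗ χ) (a , b) (difference F p)) ²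
      ≡⟨ ∑-cartesianProduct (allVecs n) (allVecs m) _ ⟨
    ∑[ v ∈ cartesianProduct (allVecs n) (allVecs m) ] (∑[ p ∈ allPairs n ] (χ ⊗ χ) v (difference F p)) ²
      ≡⟨ plancherel₁ (⊗-orthogonal (χ-orthogonal n) (χ-orthogonal m)) (allPairs n) (difference F) ⟩
    (N n * N m) * quadruples F ∎
    where open ≡-Reasoning

  -- APN functions

  ∑-δ⊗δ-difference : ∀ {n m} (F : 𝔽₂^ n → 𝔽₂^ m) (x y : 𝔽₂^ n) →
    ∑[ q ∈ allPairs n ] (δ ⊗ δ) (difference F (x , y)) (difference F q)
      ≡ + count (λ z → (F (z ⊕ (x ⊕ y)) ⊕ F z) ≟v (F x ⊕ F y))
  ∑-δ⊗δ-difference {n} F x y = begin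
    ∑[ q ∈ allPairs n ] (δ ⊗ δ) (difference F (x , y)) (difference F q)
      ≡⟨ ∑-cartesianProduct (allVecs n) (allVecs n) _ ⟩
    ∑[ z ∈ allVecs n ] ∑[ w ∈ allVecs n ] (δ (x ⊕ y) (z ⊕ w) * δ (F x ⊕ F y) (F z ⊕ F w))
      ≡⟨ ∑-cong (allVecs n) (λ z → ∑-cong (allVecs n) (λ w → cong (_* δ (F x ⊕ F y) (F z ⊕ F w)) (partner z w))) ⟩
    ∑[ z ∈ allVecs n ] ∑[ w ∈ allVecs n ] (δ (z ⊕ (x ⊕ y)) w * δ (F x ⊕ F y) (F z ⊕ F w))
      ≡⟨ ∑-cong (allVecs n) (λ z → ∑-δ-* n (z ⊕ (x ⊕ y)) (λ w → δ (F x ⊕ F y) (F z ⊕ F w))) ⟩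
    ∑[ z ∈ allVecs n ] δ (F x ⊕ F y) (F z ⊕ F (z ⊕ (x ⊕ y)))
      ≡⟨ ∑-cong (allVecs n) (λ z → δ-cong-⇔ (λ e → trans (⊕-comm _ (F z)) (sym e)) (λ e → sym (trans (⊕-comm (F z) _) e))) ⟩
    ∑[ z ∈ allVecs n ] 𝟙 ((F (z ⊕ (x ⊕ y)) ⊕ F z) ≟v (F x ⊕ F y))
      ≡⟨ length-filter≡∑𝟙 (λ z → (F (z ⊕ (x ⊕ y)) ⊕ F z) ≟v (F x ⊕ F y)) (allVecs n) ⟨
    + count (λ z → (F (z ⊕ (x ⊕ y)) ⊕ F z) ≟v (F x ⊕ F y)) ∎
    where
    open ≡-Reasoning
    partner : ∀ z w → δ (x ⊕ y) (z ⊕ w) ≡ δ (z ⊕ (x ⊕ y)) w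
    partner z w = δ-cong-⇔ (λ e → trans (cong (z ⊕_) e) (⊕-cancelˡ z w))
                           (λ e → trans (sym (⊕-cancelˡ z (x ⊕ y))) (cong (z ⊕_) e))

  module _ {n} {F : 𝔽₂^ n → 𝔽₂^ n} (apn : IsAPN F) where

    derivative-count≤ : ∀ x y → + count (λ z → (F (z ⊕ (x ⊕ y)) ⊕ F z) ≟v (F x ⊕ F y)) ≤ (N n - + 2) * δ x y + + 2
    derivative-count≤ x y with x ≟v y
    ... | yes refl = begin
      + count (λ z → (F (z ⊕ (x ⊕ x)) ⊕ F z) ≟v (F x ⊕ F x))
        ≤⟨ +≤+ (ℕ.≤-trans (length-filter (λ z → (F (z ⊕ (x ⊕ x)) ⊕ F z) ≟v (F x ⊕ F x)) (allVecs n))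
                          (ℕ.≤-reflexive (length-allVecs n))) ⟩
      N n
        ≡⟨ rearrange (N n) ⟩
      (N n - + 2) * + 1 + + 2 ∎
      where
      open ℤ.≤-Reasoning
      rearrange : ∀ k → k ≡ (k - + 2) * + 1 + + 2
      rearrange = solve-∀
    ... | no x≢y = begin
      + count (λ z → (F (z ⊕ (x ⊕ y)) ⊕ F z) ≟v (F x ⊕ F y))
        ≤⟨ +≤+ (apn (x ⊕ y) (F x ⊕ F y) (x≢y ∘ ⊕≡𝟎⇒≡ x y)) ⟩
      + 2
        ≡⟨ cong (_+ + 2) (ℤ.*-zeroʳ (N n - + 2)) ⟨
      (N n - + 2) * + 0 + + 2 ∎
      where open ℤ.≤-Reasoning

    quadruples≤ : quadruples F ≤ N n * (+ 3 * N n - + 2)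
    quadruples≤ = begin
      quadruples F
        ≡⟨ ∑-cartesianProduct (allVecs n) (allVecs n) _ ⟩
      ∑[ x ∈ allVecs n ] ∑[ y ∈ allVecs n ] ∑[ q ∈ allPairs n ] (δ ⊗ δ) (difference F (x , y)) (difference F q)
        ≡⟨ ∑-cong (allVecs n) (λ x → ∑-cong (allVecs n) (∑-δ⊗δ-difference F x)) ⟩
      ∑[ x ∈ allVecs n ] ∑[ y ∈ allVecs n ] + count (λ z → (F (z ⊕ (x ⊕ y)) ⊕ F z) ≟v (F x ⊕ F y))
        ≤⟨ ∑-mono-≤ (allVecs n) (λ x → ∑-mono-≤ (allVecs n) (derivative-count≤ x)) ⟩
      ∑[ x ∈ allVecs n ] ∑[ y ∈ allVecs n ] ((N n - + 2) * δ x y + + 2)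
        ≡⟨ ∑-cong (allVecs n) row ⟩
      ∑[ x ∈ allVecs n ] ((N n - + 2) * + 1 + + 2 * N n)
        ≡⟨ ∑-allVecs-const n _ ⟩
      ((N n - + 2) * + 1 + + 2 * N n) * N n
        ≡⟨ rearrange (N n) ⟩
      N n * (+ 3 * N n - + 2) ∎
      where
      open ℤ.≤-Reasoning
      rearrange : ∀ k → ((k - + 2) * + 1 + + 2 * k) * k ≡ k * (+ 3 * k - + 2)
      rearrange = solve-∀
      row : ∀ x → ∑[ y ∈ allVecs n ] ((N n - + 2) * δ x y + + 2) ≡ (N n - + 2) * + 1 + + 2 * N n
      row x = trans (∑-distrib-+ (allVecs n) _ _) (cong₂ _+_
        (trans (∑-*ˡ (allVecs n) (N n - + 2) (δ x)) (cong ((N n - + 2) *_) (∑-δ n x)))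
        (∑-allVecs-const n (+ 2)))

  -- Preimage sizes

  preimageCount : ∀ {n m} → (𝔽₂^ n → 𝔽₂^ m) → 𝔽₂^ m → ℕ
  preimageCount F z = count (λ x → F x ≟v z)

  preimageCount≡∑δ : ∀ {n m} (F : 𝔽₂^ n → 𝔽₂^ m) z → + preimageCount F z ≡ ∑[ x ∈ allVecs n ] δ (F x) z
  preimageCount≡∑δ {n} F z = length-filter≡∑𝟙 (λ x → F x ≟v z) (allVecs n)

  collisions≡∑preimageCount² : ∀ {n m} (F : 𝔽₂^ n → 𝔽₂^ m) →
    collisions F ≡ ∑[ z ∈ allVecs m ] (+ preimageCount F z) ²
  collisions≡∑preimageCount² {n} {m} F = sym (begin
    ∑[ z ∈ allVecs m ] (+ preimageCount F z) ²
      ≡⟨ ∑-cong (allVecs m) (λ z → cong _² (preimageCount≡∑δ F z)) ⟩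
    ∑[ z ∈ allVecs m ] (∑[ x ∈ allVecs n ] δ (F x) z) ²
      ≡⟨ ∑-cong (allVecs m) (λ z → ∑-*-∑ (allVecs n) (allVecs n) (λ x → δ (F x) z) (λ y → δ (F y) z)) ⟩
    ∑[ z ∈ allVecs m ] ∑[ x ∈ allVecs n ] ∑[ y ∈ allVecs n ] (δ (F x) z * δ (F y) z)
      ≡⟨ trans (∑-comm (allVecs m) (allVecs n) _) (∑-cong (allVecs n) (λ x → ∑-comm (allVecs m) (allVecs n) _)) ⟩
    ∑[ x ∈ allVecs n ] ∑[ y ∈ allVecs n ] ∑[ z ∈ allVecs m ] (δ (F x) z * δ (F y) z)
      ≡⟨ ∑-cong (allVecs n) (λ x → ∑-cong (allVecs n) (λ y → trans (∑-δ-* m (F x) (λ z → δ (F y) z)) (δ-sym (F y) (F x)))) ⟩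
    collisions F ∎)
    where open ≡-Reasoning

  ∑-preimageCount : ∀ {n m} (F : 𝔽₂^ n → 𝔽₂^ m) → ∑[ z ∈ allVecs m ] + preimageCount F z ≡ N n
  ∑-preimageCount {n} {m} F = begin
    ∑[ z ∈ allVecs m ] + preimageCount F z         ≡⟨ ∑-cong (allVecs m) (preimageCount≡∑δ F) ⟩
    ∑[ z ∈ allVecs m ] ∑[ x ∈ allVecs n ] δ (F x) z ≡⟨ ∑-comm (allVecs m) (allVecs n) _ ⟩
    ∑[ x ∈ allVecs n ] ∑[ z ∈ allVecs m ] δ (F x) z ≡⟨ ∑-cong (allVecs n) (λ x → ∑-δ m (F x)) ⟩
    ∑[ x ∈ allVecs n ] + 1                         ≡⟨ ∑-allVecs-const n (+ 1) ⟩
    + 1 * N n                                      ≡⟨ ℤ.*-identityˡ (N n) ⟩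
    N n                                            ∎
    where open ≡-Reasoning

  module _ {n} (F : 𝔽₂^ n → 𝔽₂^ n) where

    inImage? : ∀ z → Dec (Any (λ x → F x ≡ z) (allVecs n))
    inImage? z = any? (λ x → F x ≟v z) (allVecs n)

    5*preimageCount≤ : ∀ z → + 5 * + preimageCount F z ≤ (+ preimageCount F z) ² + + 6 * 𝟙 (inImage? z)
    5*preimageCount≤ z with inImage? z
    ... | yes _ = subst₂ _≤_ (ℤ.pos-* 5 k) (cong (_+ + 6) (ℤ.pos-* k k)) (+≤+ (5*k≤k*k+6 k))
      where
      k : ℕ
      k = preimageCount F z
    ... | no ∉image rewrite filter-none (λ x → F x ≟v z) (¬Any⇒All¬ (allVecs n) ∉image) = +≤+ ℕ.z≤n

    5N≤collisions+6*imageSize : + 5 * N n ≤ collisions F + + 6 * + imageSize F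
    5N≤collisions+6*imageSize = begin
      + 5 * N n
        ≡⟨ cong (+ 5 *_) (∑-preimageCount F) ⟨
      + 5 * ∑[ z ∈ allVecs n ] + preimageCount F z
        ≡⟨ ∑-*ˡ (allVecs n) (+ 5) _ ⟨
      ∑[ z ∈ allVecs n ] (+ 5 * + preimageCount F z)
        ≤⟨ ∑-mono-≤ (allVecs n) 5*preimageCount≤ ⟩
      ∑[ z ∈ allVecs n ] ((+ preimageCount F z) ² + + 6 * 𝟙 (inImage? z))
        ≡⟨ ∑-distrib-+ (allVecs n) _ _ ⟩
      ∑[ z ∈ allVecs n ] (+ preimageCount F z) ² + ∑[ z ∈ allVecs n ] (+ 6 * 𝟙 (inImage? z))
        ≡⟨ cong₂ _+_ (collisions≡∑preimageCount² F) (sym (∑-*ˡ (allVecs n) (+ 6) _)) ⟨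
      collisions F + + 6 * ∑[ z ∈ allVecs n ] 𝟙 (inImage? z)
        ≡⟨ cong (λ t → collisions F + + 6 * t) (length-filter≡∑𝟙 inImage? (allVecs n)) ⟨
      collisions F + + 6 * + imageSize F ∎
      where open ℤ.≤-Reasoning

  -- The amplitude of a balanced component

  module _ {n} {F : 𝔽₂^ n → 𝔽₂^ n} (amplitudes : ∀ b → ∃ λ h → HasAmplitude h (component F b))
           (b₀ : 𝔽₂^ n) {h₀} (amplitude₀ : HasAmplitude h₀ (component F b₀)) (unbiased : walsh (component F b₀) 𝟎 ≡ + 0) where

    private
      W : 𝔽₂^ n → 𝔽₂^ n → ℤ
      W b = walsh (component F b)

    fourth-moment≥ : ∀ b → (N n * N n) * (W b 𝟎 ² + δ b₀ b * Λ h₀) ≤ ∑[ a ∈ allVecs n ] (W b a ²) ²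
    fourth-moment≥ b with b₀ ≟v b
    ... | yes refl = ℤ.≤-reflexive (begin
      (N n * N n) * (W b₀ 𝟎 ² + + 1 * Λ h₀)  ≡⟨ cong (λ w → (N n * N n) * (w ² + + 1 * Λ h₀)) unbiased ⟩
      (N n * N n) * (+ 0 + + 1 * Λ h₀)       ≡⟨ cong ((N n * N n) *_) (trans (ℤ.+-identityˡ _) (ℤ.*-identityˡ (Λ h₀))) ⟩
      (N n * N n) * Λ h₀                     ≡⟨ ℤ.*-comm (N n * N n) (Λ h₀) ⟩
      Λ h₀ * (N n * N n)                     ≡⟨ ∑-walsh⁴≡Λ*N² amplitude₀ ⟨
      ∑[ a ∈ allVecs n ] (W b₀ a ²) ²        ∎)
      where open ≡-Reasoning
    ... | no _ with amplitudes b
    ...   | h , b-amplitude = begin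
      (N n * N n) * (W b 𝟎 ² + + 0 * Λ h₀)  ≡⟨ cong (λ t → (N n * N n) * (W b 𝟎 ² + t)) (ℤ.*-zeroˡ (Λ h₀)) ⟩
      (N n * N n) * (W b 𝟎 ² + + 0)         ≡⟨ cong ((N n * N n) *_) (ℤ.+-identityʳ (W b 𝟎 ²)) ⟩
      (N n * N n) * W b 𝟎 ²                 ≤⟨ ℤ.*-monoˡ-≤-nonNeg _ {{nonNegative (0≤N*N n)}} (walsh²≤Λ b-amplitude 𝟎) ⟩
      (N n * N n) * Λ h                     ≡⟨ ℤ.*-comm (N n * N n) (Λ h) ⟩
      Λ h * (N n * N n)                     ≡⟨ ∑-walsh⁴≡Λ*N² b-amplitude ⟨
      ∑[ a ∈ allVecs n ] (W b a ²) ²        ∎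
      where open ℤ.≤-Reasoning

    N*collisions+Λ≤quadruples : N n * collisions F + Λ h₀ ≤ quadruples F
    N*collisions+Λ≤quadruples = ℤ.*-cancelˡ-≤-pos _ _ (N n) {{N-positive n}} (ℤ.*-cancelˡ-≤-pos _ _ (N n) {{N-positive n}} (begin
      N n * (N n * (N n * collisions F + Λ h₀))
        ≡⟨ ℤ.*-assoc (N n) (N n) _ ⟨
      (N n * N n) * (N n * collisions F + Λ h₀)
        ≡⟨ cong ((N n * N n) *_) (cong₂ _+_ (∑-walsh-at-𝟎² F) (∑-δ-* n b₀ (λ _ → Λ h₀))) ⟨
      (N n * N n) * (∑[ b ∈ allVecs n ] W b 𝟎 ² + ∑[ b ∈ allVecs n ] (δ b₀ b * Λ h₀))
        ≡⟨ trans (∑-*ˡ (allVecs n) (N n * N n) _) (cong ((N n * N n) *_) (∑-distrib-+ (allVecs n) _ _)) ⟨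
      ∑[ b ∈ allVecs n ] ((N n * N n) * (W b 𝟎 ² + δ b₀ b * Λ h₀))
        ≤⟨ ∑-mono-≤ (allVecs n) fourth-moment≥ ⟩
      ∑[ b ∈ allVecs n ] ∑[ a ∈ allVecs n ] (W b a ²) ²
        ≡⟨ ∑-walsh⁴≡quadruples F ⟩
      (N n * N n) * quadruples F
        ≡⟨ ℤ.*-assoc (N n) (N n) _ ⟩
      N n * (N n * quadruples F) ∎))
      where open ℤ.≤-Reasoning

  Λ≤2N : ∀ {N C Q Λ I : ℤ} → + 0 ≤ N → N * C + Λ ≤ Q → Q ≤ N * (+ 3 * N - + 2) →
    + 5 * N ≤ C + + 6 * I → + 3 * I ≡ N + + 2 → Λ ≤ + 2 * N
  Λ≤2N {N} {C} {Q} {Λ} {I} 0≤N lower upper collisions-bound image =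
    ℤ.0≤i-j⇒j≤i (subst (+ 0 ≤_) (combination N C Q Λ)
      (ℤ.+-mono-≤ (ℤ.+-mono-≤ (ℤ.i≤j⇒0≤j-i lower) (ℤ.i≤j⇒0≤j-i upper)) 0≤N*slack))
    where
    combination : ∀ N C Q Λ → (Q - (N * C + Λ)) + (N * (+ 3 * N - + 2) - Q) + N * (C + + 2 * (N + + 2) - + 5 * N) ≡ + 2 * N - Λ
    combination = solve-∀
    regroup : ∀ C I → C + + 6 * I ≡ C + + 2 * (+ 3 * I)
    regroup = solve-∀
    0≤slack : + 0 ≤ C + + 2 * (N + + 2) - + 5 * N
    0≤slack = ℤ.i≤j⇒0≤j-i (subst (λ t → + 5 * N ≤ C + + 2 * t) image (subst (+ 5 * N ≤_) (regroup C I) collisions-bound))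
    0≤N*slack : + 0 ≤ N * (C + + 2 * (N + + 2) - + 5 * N)
    0≤N*slack = subst (_≤ N * (C + + 2 * (N + + 2) - + 5 * N)) (ℤ.*-zeroʳ N) (ℤ.*-monoˡ-≤-nonNeg N {{nonNegative 0≤N}} 0≤slack)

  amplitude≤2^[n+1] : ∀ {n h} {F : 𝔽₂^ n → 𝔽₂^ n} → IsPlateaued F → IsAPN F → 3 ℕ.* imageSize F ≡ 2 ^ n ℕ.+ 2 →
    ∀ b → HasAmplitude h (component F b) → walsh (component F b) 𝟎 ≡ + 0 → 2 ^ h ℕ.* 2 ^ h ℕ.≤ 2 ℕ.* 2 ^ n
  amplitude≤2^[n+1] {n} {F = F} plateaued apn image b b-amplitude unbiased =
    ℤ.drop‿+≤+ (subst (_ ≤_) (sym (ℤ.pos-* 2 (2 ^ n)))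
      (Λ≤2N {I = + imageSize F} (+≤+ ℕ.z≤n) (N*collisions+Λ≤quadruples (plateaued⇒amplitudes plateaued) b b-amplitude unbiased)
            (quadruples≤ {F = F} apn) (5N≤collisions+6*imageSize F) (trans (sym (ℤ.pos-* 3 (imageSize F))) (cong +_ image))))

  balanced-amplitude∈ : ∀ {k h} {F : 𝔽₂^ (suc k) → 𝔽₂^ (suc k)} →
    IsPlateaued F → IsAPN F → 3 ℕ.* imageSize F ≡ 2 ^ suc k ℕ.+ 2 →
    ∀ b → IsBalanced (component F b) → HasAmplitude h (component F b) →
    2 ^ suc k ℕ.< 2 ^ h ℕ.* 2 ^ h × 2 ^ h ℕ.* 2 ^ h ℕ.≤ 2 ℕ.* 2 ^ suc k
  balanced-amplitude∈ {k} {F = F} plateaued apn image b balanced b-amplitude =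
    unbiased⇒2^n<Λ b-amplitude unbiased , amplitude≤2^[n+1] plateaued apn image b b-amplitude unbiased
    where
    unbiased : walsh (component F b) 𝟎 ≡ + 0
    unbiased = balanced⇒walsh-at-𝟎≡0 k (component F b) balanced

open import Data.Nat using (_+_; _*_)

theorem6p8 : (n : ℕ) → IsEven n → (F : 𝔽₂^ n → 𝔽₂^ n) → IsPlateaued F → IsAPN F → 3 * imageSize F ≡ 2 ^ n + 2 → (b : 𝔽₂^ n) → ¬ (b ≡ 𝟎) → ¬ IsBalanced (component F b)
theorem6p8 zero _ F _ _ _ [] b≢𝟎 _ = b≢𝟎 refl
theorem6p8 n@(suc _) (m , n≡2m) F plateaued apn image b b≢𝟎 balanced with plateaued b b≢𝟎
... | _ , h , _ , values =
  ℕ.<⇒≱ (4^m<4^h⇒2*4^m<4^h m h (subst (ℕ._< 2 ^ h * 2 ^ h) 2^n≡4^m (proj₁ bounds)))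
        (subst (λ t → 2 ^ h * 2 ^ h ℕ.≤ 2 * t) 2^n≡4^m (proj₂ bounds))
  where
  bounds : 2 ^ n ℕ.< 2 ^ h * 2 ^ h × 2 ^ h * 2 ^ h ℕ.≤ 2 * 2 ^ n
  bounds = balanced-amplitude∈ plateaued apn image b balanced (amplitude {h = h} values)
  2^n≡4^m : 2 ^ n ≡ 2 ^ m * 2 ^ m
  2^n≡4^m = trans (cong (2 ^_) n≡2m) (2^[2m]≡2^m*2^m m)
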